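{- For every integer $p\geq 2$, $\chi_{rlid}(Q_2(p))=\omega(Q_2(p))+1$.
   Context: For an integer $p\geq 2$, $Q_2(p)$ is the split graph with vertex set $\{v_1,\dots,v_p\}\cup\{s_1,\dots,s_{p-1}\}$, where $\{v_1,\dots,v_p\}$ is a clique, $\{s_1,\dots,s_{p-1}\}$ is a stable set, and the only other edges are $v_is_i$ for $i=1,\dots,p-1$. $\omega(H)$ is the maximum size of a clique of $H$. For a vertex $x$, $N[x]$ is its closed neighborhood. An $rlid$-coloring of a graph $H$ is a map $c:V(H)\to\mathbb{N}$ (not necessarily proper) such that for every pair of adjacent vertices $u,v$ with $N[u]\neq N[v]$ we have $c(N[u])\neq c(N[v])$, where $c(X)=\{c(x):x\in X\}$; $\chi_{rlid}(H)$ is the minimum number of colors in an $rlid$-coloring of $H$. -}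

module Defs where

open import Data.Nat using (ℕ; _<_; _∸_)
open import Data.Fin using (Fin; toℕ)
open import Data.Sum using (_⊎_; inj₁; inj₂)
open import Data.Product using (Σ; ∃; _×_)
open import Data.Empty using (⊥)
open import Data.List using (List; length)
open import Data.List.Membership.Propositional using (_∈_)
open import Data.List.Relation.Unary.Unique.Propositional using (Unique)
open import Relation.Nullary using (¬_)
open import Relation.Binary.PropositionalEquality using (_≡_; _≢_)
open import Function.Bundles using (_⇔_)

record Graph : Set₁ where
  field
    V   : Set
    Adj : V → V → Set

open Graph public

_∈N[_] : {G : Graph} → V G → V G → Set
_∈N[_] {G} x u = (x ≡ u) ⊎ Adj G u x

SameN : (G : Graph) → V G → V G → Set
SameN G u v = ∀ x → (_∈N[_] {G} x u) ⇔ (_∈N[_] {G} x v)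

_∈c[N[_]] : {G : Graph} → ℕ → (V G → ℕ) × V G → Set
_∈c[N[_]] {G} k (c Data.Product., u) = Σ (V G) λ x → (_∈N[_] {G} x u) × (c x ≡ k)

SameColN : (G : Graph) → (V G → ℕ) → V G → V G → Set
SameColN G c u v =
  ∀ k → (_∈c[N[_]] {G} k (c Data.Product., u)) ⇔ (_∈c[N[_]] {G} k (c Data.Product., v))

-- rlid-coloring (not necessarily proper)
IsRlidColoring : (G : Graph) → (V G → ℕ) → Set
IsRlidColoring G c =
  ∀ u v → Adj G u v → ¬ SameN G u v → ¬ SameColN G c u v

UsesAtMost : (G : Graph) → (V G → ℕ) → ℕ → Set
UsesAtMost G c k = ∀ x → c x < k

IsChiRlid : Graph → ℕ → Set
IsChiRlid G k =
  (Σ (V G → ℕ) λ c → IsRlidColoring G c × UsesAtMost G c k)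
  × (∀ (m : ℕ) (c : V G → ℕ) → IsRlidColoring G c → UsesAtMost G c m → ¬ (m < k))

IsClique : (G : Graph) → List (V G) → Set
IsClique G xs = Unique xs × (∀ x y → x ∈ xs → y ∈ xs → x ≢ y → Adj G x y)

IsCliqueNumber : Graph → ℕ → Set
IsCliqueNumber G w =
  (Σ (List (V G)) λ xs → IsClique G xs × length xs ≡ w)
  × (∀ xs → IsClique G xs → ¬ (w < length xs))

-- Q₂(p): vertices v_i = inj₁ i (i : Fin p, clique), s_j = inj₂ j (j : Fin (p ∸ 1), stable),
-- with v_i s_i edges (0-indexed: inj₁ i ~ inj₂ j iff toℕ i ≡ toℕ j).
Q2Adj : (p : ℕ) → Fin p ⊎ Fin (p ∸ 1) → Fin p ⊎ Fin (p ∸ 1) → Set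
Q2Adj p (inj₁ i) (inj₁ j) = i ≢ j
Q2Adj p (inj₁ i) (inj₂ j) = toℕ i ≡ toℕ j
Q2Adj p (inj₂ j) (inj₁ i) = toℕ i ≡ toℕ j
Q2Adj p (inj₂ i) (inj₂ j) = ⊥

Q2 : ℕ → Graph
Q2 p = record { V = Fin p ⊎ Fin (p ∸ 1) ; Adj = Q2Adj p }

-- The p clique vertices form a maximum clique, so ω(Q₂(p)) = p. In an rlid-colouring c, two clique
-- vertices vᵢ, vₗ are adjacent and have different closed neighbourhoods whenever one of them carries a
-- pendant; their neighbourhoods share the whole clique and differ only in the pendants, so c must tell
-- the pendants apart. This forces the p − 1 pendant colours to be pairwise distinct (compare vⱼ with vⱼ')
-- and different from every clique colour (compare vⱼ with the pendant-free v_{p−1}), while comparing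
-- v₀ with s₀ shows the clique is not monochromatic: at least p + 1 colours. Colouring v₀ with 0, the
-- other clique vertices with 1 and sⱼ with 2 + j attains this bound.
module Submission where

open import Defs
open import Data.Nat using (ℕ; suc; _≤_; _<_; _+_; z≤n; s≤s)
open import Data.Nat.Properties
  using (≤-antisym; ≮⇒≥; ≤⇒≯; <⇒≢; +-comm; suc-injective; _≟_)
open import Data.Fin as Fin using (Fin; toℕ; fromℕ; fromℕ<; inject₁; lower₁)
open import Data.Fin.Properties
  using (toℕ-injective; toℕ<n; toℕ-fromℕ; toℕ-fromℕ<; toℕ-inject₁; toℕ-lower₁;
         injective⇒≤; ¬∀⟶∃¬)
  renaming (_≟_ to _≟ᶠ_)
open import Data.Sum using (inj₁; inj₂)
open import Data.Sum.Properties using (inj₁-injective; ≡-dec)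
open import Data.Product using (Σ; _×_; _,_)
open import Data.Empty using (⊥-elim)
open import Data.List using (List; _∷_; length; lookup; tabulate)
open import Data.List.Properties using (length-tabulate)
open import Data.List.Membership.Propositional using (_∈_)
open import Data.List.Membership.Propositional.Properties using (∈-lookup; ∈-tabulate⁻)
open import Data.List.Relation.Unary.Unique.Propositional using (Unique)
open import Data.List.Relation.Unary.Unique.Propositional.Properties using (tabulate⁺)
open import Data.List.Relation.Unary.AllPairs using (_∷_)
import Data.List.Relation.Unary.All as All
open import Relation.Nullary using (¬_; yes; no)
open import Relation.Binary.PropositionalEquality using (_≡_; _≢_; refl; sym; trans; cong; subst)
open import Function using (_∘′_)
open import Function.Bundles using (mk⇔; Equivalence)

lookup-injective : ∀ {A : Set} {xs : List A} → Unique xs →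
                   ∀ i j → lookup xs i ≡ lookup xs j → i ≡ j
lookup-injective (px ∷ u) Fin.zero    Fin.zero    e = refl
lookup-injective (px ∷ u) Fin.zero    (Fin.suc j) e = ⊥-elim (All.lookup px (∈-lookup j) e)
lookup-injective (px ∷ u) (Fin.suc i) Fin.zero    e = ⊥-elim (All.lookup px (∈-lookup i) (sym e))
lookup-injective (px ∷ u) (Fin.suc i) (Fin.suc j) e = cong Fin.suc (lookup-injective u i j e)

Unique-length≤ : ∀ {A : Set} {n} (h : A → Fin n) {xs : List A} → Unique xs →
                 (∀ {x y} → x ∈ xs → y ∈ xs → h x ≡ h y → x ≡ y) → length xs ≤ n
Unique-length≤ h u h-inj =
  injective⇒≤ (λ {i} {j} e → lookup-injective u i j (h-inj (∈-lookup i) (∈-lookup j) e))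

module _ (G : Graph) (c : V G → ℕ) where

  colours-injective⇒≤ : ∀ {k m} (g : Fin k → V G) → (∀ a b → c (g a) ≡ c (g b) → a ≡ b) →
                        UsesAtMost G c m → k ≤ m
  colours-injective⇒≤ g inj c<m = injective⇒≤ {f = λ a → fromℕ< (c<m (g a))} λ {a} {b} e →
    inj a b (trans (sym (toℕ-fromℕ< (c<m (g a)))) (trans (cong toℕ e) (toℕ-fromℕ< (c<m (g b)))))

  ColN⊆ : V G → V G → Set
  ColN⊆ u v = ∀ x → _∈N[_] {G} x u → Σ (V G) λ y → _∈N[_] {G} y v × c y ≡ c x

  ColN⊆-antisym : ∀ {u v} → ColN⊆ u v → ColN⊆ v u → SameColN G c u v
  ColN⊆-antisym u⊆v v⊆u k = mk⇔ (cover u⊆v) (cover v⊆u)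
    where
    cover : ∀ {u v} → ColN⊆ u v → _∈c[N[_]] {G} k (c , u) → _∈c[N[_]] {G} k (c , v)
    cover ⊆ (x , x∈N , refl) with ⊆ x x∈N
    ... | y , y∈N , e = y , y∈N , e

  SameColN-sym : ∀ {u v} → SameColN G c u v → SameColN G c v u
  SameColN-sym S k = mk⇔ (Equivalence.from (S k)) (Equivalence.to (S k))

-- Q₂(p) for p = 2 + q, so that v₀, v₁ and s₀ exist.
module Q₂ (q : ℕ) where

  G : Graph
  G = Q2 (suc (suc q))

  _∈N_ : V G → V G → Set
  x ∈N u = _∈N[_] {G} x u

  clique∈N : ∀ i l → inj₁ l ∈N inj₁ i
  clique∈N i l with l ≟ᶠ i
  ... | yes l≡i = inj₁ (cong inj₁ l≡i)
  ... | no l≢i  = inj₂ (λ i≡l → l≢i (sym i≡l))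

  last : Fin (suc (suc q))
  last = fromℕ (suc q)

  last-has-no-pendant : ∀ (j : Fin (suc q)) → toℕ last ≢ toℕ j
  last-has-no-pendant j e = <⇒≢ (toℕ<n j) (trans (sym e) (toℕ-fromℕ (suc q)))

  clique : List (V G)
  clique = tabulate inj₁

  clique-isClique : IsClique G clique
  clique-isClique = tabulate⁺ inj₁-injective , adjacent
    where
    adjacent : ∀ x y → x ∈ clique → y ∈ clique → x ≢ y → Adj G x y
    adjacent x y x∈ y∈ x≢y with ∈-tabulate⁻ {f = inj₁} x∈ | ∈-tabulate⁻ {f = inj₁} y∈
    ... | i , refl | l , refl = λ i≡l → x≢y (cong inj₁ i≡l)

  -- Pendants share the slot of the pendant-free v_{p−1}, so adjacent vertices never share a slot.
  slot : V G → Fin (suc (suc q))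
  slot (inj₁ i) = i
  slot (inj₂ _) = last

  adjacent⇒slot≢ : ∀ x y → Adj G x y → slot x ≢ slot y
  adjacent⇒slot≢ (inj₁ i) (inj₁ l) i≢l e = i≢l e
  adjacent⇒slot≢ (inj₁ i) (inj₂ j) a   e = last-has-no-pendant j (trans (cong toℕ (sym e)) a)
  adjacent⇒slot≢ (inj₂ j) (inj₁ l) a   e = last-has-no-pendant j (trans (cong toℕ e) a)

  clique-length≤ : ∀ xs → IsClique G xs → length xs ≤ suc (suc q)
  clique-length≤ xs (u , adj) = Unique-length≤ slot u slot-inj
    where
    slot-inj : ∀ {x y} → x ∈ xs → y ∈ xs → slot x ≡ slot y → x ≡ y
    slot-inj {x} {y} x∈ y∈ e with ≡-dec _≟ᶠ_ _≟ᶠ_ x y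
    ... | yes x≡y = x≡y
    ... | no x≢y  = ⊥-elim (adjacent⇒slot≢ x y (adj x y x∈ y∈ x≢y) e)

  cliqueNumber≡ : ∀ {w} → IsCliqueNumber G w → w ≡ suc (suc q)
  cliqueNumber≡ ((xs , xs-clique , refl) , maximal) =
    ≤-antisym (clique-length≤ xs xs-clique) (≮⇒≥ λ w<p →
      maximal clique clique-isClique (subst (length xs <_) (sym (length-tabulate inj₁)) w<p))

  colouring : V G → ℕ
  colouring (inj₁ Fin.zero)    = 0
  colouring (inj₁ (Fin.suc _)) = 1
  colouring (inj₂ j)           = 2 + toℕ j

  colouring< : ∀ x → colouring x < 3 + q
  colouring< (inj₁ Fin.zero)    = s≤s z≤n
  colouring< (inj₁ (Fin.suc _)) = s≤s (s≤s z≤n)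
  colouring< (inj₂ j)           = s≤s (s≤s (toℕ<n j))

  clique-colour<2 : ∀ i → colouring (inj₁ i) < 2
  clique-colour<2 Fin.zero    = s≤s z≤n
  clique-colour<2 (Fin.suc _) = s≤s (s≤s z≤n)

  pendant-colour≮2 : ∀ j → ¬ colouring (inj₂ j) < 2
  pendant-colour≮2 j (s≤s (s≤s ()))

  pendant-colour-private : ∀ (j : Fin (suc q)) i → toℕ i ≢ toℕ j →
                           ¬ _∈c[N[_]] {G} (2 + toℕ j) (colouring , inj₁ i)
  pendant-colour-private j i _ (inj₁ l , _ , e) =
    pendant-colour≮2 j (subst (_< 2) e (clique-colour<2 l))
  pendant-colour-private j i i≢j (inj₂ j' , inj₂ i≡j' , e) =
    i≢j (trans i≡j' (suc-injective (suc-injective e)))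

  pendant-separates : ∀ i i' (j : Fin (suc q)) → toℕ i ≡ toℕ j → toℕ i' ≢ toℕ j →
                      ¬ SameColN G colouring (inj₁ i) (inj₁ i')
  pendant-separates i i' j i≡j i'≢j S =
    pendant-colour-private j i' i'≢j (Equivalence.to (S (2 + toℕ j)) (inj₂ j , inj₂ i≡j , refl))

  -- Of two distinct clique vertices at most one is the pendant-free v_{p−1}.
  colouring-separates-clique : ∀ i i' → i ≢ i' → ¬ SameColN G colouring (inj₁ i) (inj₁ i')
  colouring-separates-clique i i' i≢i' with suc q ≟ toℕ i
  ... | no  i≢last = pendant-separates i i' (lower₁ i i≢last) (sym (toℕ-lower₁ i i≢last))
          λ e → i≢i' (toℕ-injective (sym (trans e (toℕ-lower₁ i i≢last))))
  ... | yes i≡last = λ S →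
          pendant-separates i' i (lower₁ i' i'≢last) (sym (toℕ-lower₁ i' i'≢last))
          (λ e → i≢i' (toℕ-injective (trans e (toℕ-lower₁ i' i'≢last))))
          (SameColN-sym G colouring S)
    where
    i'≢last : suc q ≢ toℕ i'
    i'≢last e = i≢i' (toℕ-injective (trans (sym i≡last) e))

  low-colour-in-N[s]-unique : ∀ j {x y} → x ∈N inj₂ j → y ∈N inj₂ j →
                              colouring x < 2 → colouring y < 2 → x ≡ y
  low-colour-in-N[s]-unique j {inj₂ j'} _ _ x<2 _ = ⊥-elim (pendant-colour≮2 j' x<2)
  low-colour-in-N[s]-unique j {y = inj₂ j'} _ _ _ y<2 = ⊥-elim (pendant-colour≮2 j' y<2)
  low-colour-in-N[s]-unique j {inj₁ l} {inj₁ l'} (inj₂ l≡j) (inj₂ l'≡j) _ _ =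
    cong inj₁ (toℕ-injective (trans l≡j (sym l'≡j)))

  -- N[vᵢ] shows the colours 0 and 1, but N[sⱼ] has only one vertex of colour below 2.
  colouring-separates-pendant : ∀ i j → ¬ SameColN G colouring (inj₁ i) (inj₂ j)
  colouring-separates-pendant i j S
    with Equivalence.to (S 0) (inj₁ Fin.zero , clique∈N i Fin.zero , refl)
       | Equivalence.to (S 1) (inj₁ (Fin.suc Fin.zero) , clique∈N i (Fin.suc Fin.zero) , refl)
  ... | x₀ , x₀∈N , c₀ | x₁ , x₁∈N , c₁
    with low-colour-in-N[s]-unique j x₀∈N x₁∈N (subst (_< 2) (sym c₀) (s≤s z≤n))
                                               (subst (_< 2) (sym c₁) (s≤s (s≤s z≤n)))
  ... | refl with trans (sym c₀) c₁
  ... | ()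

  colouring-rlid : IsRlidColoring G colouring
  colouring-rlid (inj₁ i) (inj₁ i') i≢i' _ = colouring-separates-clique i i' i≢i'
  colouring-rlid (inj₁ i) (inj₂ j)  _    _ = colouring-separates-pendant i j
  colouring-rlid (inj₂ j) (inj₁ i)  _    _ = colouring-separates-pendant i j ∘′ SameColN-sym G colouring

  inject₁-pendant : ∀ {j k : Fin (suc q)} → toℕ (inject₁ j) ≡ toℕ k → j ≡ k
  inject₁-pendant {j} e = toℕ-injective (trans (sym (toℕ-inject₁ j)) e)

  pendant⇒¬SameN : ∀ i i' j → toℕ i ≡ toℕ j → toℕ i' ≢ toℕ j → ¬ SameN G (inj₁ i) (inj₁ i')
  pendant⇒¬SameN i i' j i≡j i'≢j S with Equivalence.to (S (inj₂ j)) (inj₂ i≡j)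
  ... | inj₂ i'≡j = i'≢j i'≡j

  module _ (c : V G → ℕ) (rlid : IsRlidColoring G c) where

    PendantsCovered : Fin (suc (suc q)) → Fin (suc (suc q)) → Set
    PendantsCovered i i' = ∀ j → toℕ i ≡ toℕ j → Σ (V G) λ y → y ∈N inj₁ i' × c y ≡ c (inj₂ j)

    clique-ColN⊆ : ∀ i i' → PendantsCovered i i' → ColN⊆ G c (inj₁ i) (inj₁ i')
    clique-ColN⊆ i i' covered (inj₁ l) _          = inj₁ l , clique∈N i' l , refl
    clique-ColN⊆ i i' covered (inj₂ j) (inj₁ ())
    clique-ColN⊆ i i' covered (inj₂ j) (inj₂ i≡j) = covered j i≡j

    pendants-not-covered : ∀ i i' (j : Fin (suc q)) → toℕ i ≡ toℕ j → toℕ i' ≢ toℕ j →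
                           PendantsCovered i i' → ¬ PendantsCovered i' i
    pendants-not-covered i i' j i≡j i'≢j covered covered' =
      rlid (inj₁ i) (inj₁ i') (λ { refl → i'≢j i≡j }) (pendant⇒¬SameN i i' j i≡j i'≢j)
        (ColN⊆-antisym G c (clique-ColN⊆ i i' covered) (clique-ColN⊆ i' i covered'))

    -- Swapping sⱼ and sⱼ' would make the colour sets of vⱼ and vⱼ' agree.
    pendant-colours-distinct : ∀ j j' → j ≢ j' → c (inj₂ j) ≢ c (inj₂ j')
    pendant-colours-distinct j j' j≢j' e =
      pendants-not-covered (inject₁ j) (inject₁ j') j (toℕ-inject₁ j)
        (λ j'≡j → j≢j' (sym (inject₁-pendant j'≡j)))
        (λ k j≡k → inj₂ j' , inj₂ (toℕ-inject₁ j') ,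
                   trans (sym e) (cong (c ∘′ inj₂) (inject₁-pendant j≡k)))
        (λ k j'≡k → inj₂ j , inj₂ (toℕ-inject₁ j) ,
                    trans e (cong (c ∘′ inj₂) (inject₁-pendant j'≡k)))

    pendant-colour≢clique-colour : ∀ j l → c (inj₂ j) ≢ c (inj₁ l)
    pendant-colour≢clique-colour j l e =
      pendants-not-covered (inject₁ j) last j (toℕ-inject₁ j) (last-has-no-pendant j)
        (λ k j≡k → inj₁ l , clique∈N last l ,
                   trans (sym e) (cong (c ∘′ inj₂) (inject₁-pendant j≡k)))
        (λ k last≡k → ⊥-elim (last-has-no-pendant k last≡k))

    -- A monochromatic clique would give v₀ and s₀ the same colour sets.
    clique-not-monochromatic : ¬ (∀ l → c (inj₁ l) ≡ c (inj₁ Fin.zero))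
    clique-not-monochromatic mono =
      rlid (inj₁ Fin.zero) (inj₂ Fin.zero) refl v₀≁s₀ (ColN⊆-antisym G c v₀⊆s₀ s₀⊆v₀)
      where
      v₀≁s₀ : ¬ SameN G (inj₁ Fin.zero) (inj₂ Fin.zero)
      v₀≁s₀ S with Equivalence.to (S (inj₁ (Fin.suc Fin.zero))) (inj₂ (λ ()))
      ... | inj₁ ()
      ... | inj₂ ()
      v₀⊆s₀ : ColN⊆ G c (inj₁ Fin.zero) (inj₂ Fin.zero)
      v₀⊆s₀ (inj₁ l) _          = inj₁ Fin.zero , inj₂ refl , sym (mono l)
      v₀⊆s₀ (inj₂ j) (inj₁ ())
      v₀⊆s₀ (inj₂ j) (inj₂ 0≡j) = inj₂ Fin.zero , inj₁ refl , cong (c ∘′ inj₂) (toℕ-injective 0≡j)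
      s₀⊆v₀ : ColN⊆ G c (inj₂ Fin.zero) (inj₁ Fin.zero)
      s₀⊆v₀ (inj₁ l) (inj₂ l≡0) = inj₁ l , clique∈N Fin.zero l , refl
      s₀⊆v₀ (inj₂ j) (inj₁ refl) = inj₂ Fin.zero , inj₂ refl , refl

    rlid-colours≥ : ∀ {m} → UsesAtMost G c m → 3 + q ≤ m
    rlid-colours≥ c<m
      with ¬∀⟶∃¬ _ _ (λ l → c (inj₁ l) ≟ c (inj₁ Fin.zero)) clique-not-monochromatic
    ... | l , l≢0 = colours-injective⇒≤ G c witness witness-colours-injective c<m
      where
      witness : Fin (3 + q) → V G
      witness Fin.zero                = inj₁ Fin.zero
      witness (Fin.suc Fin.zero)      = inj₁ l
      witness (Fin.suc (Fin.suc j))   = inj₂ j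
      witness-colours-injective : ∀ a b → c (witness a) ≡ c (witness b) → a ≡ b
      witness-colours-injective Fin.zero              Fin.zero              e = refl
      witness-colours-injective Fin.zero              (Fin.suc Fin.zero)    e = ⊥-elim (l≢0 (sym e))
      witness-colours-injective Fin.zero              (Fin.suc (Fin.suc j)) e =
        ⊥-elim (pendant-colour≢clique-colour j Fin.zero (sym e))
      witness-colours-injective (Fin.suc Fin.zero)    Fin.zero              e = ⊥-elim (l≢0 e)
      witness-colours-injective (Fin.suc Fin.zero)    (Fin.suc Fin.zero)    e = refl
      witness-colours-injective (Fin.suc Fin.zero)    (Fin.suc (Fin.suc j)) e =
        ⊥-elim (pendant-colour≢clique-colour j l (sym e))
      witness-colours-injective (Fin.suc (Fin.suc j)) Fin.zero              e =
        ⊥-elim (pendant-colour≢clique-colour j Fin.zero e)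
      witness-colours-injective (Fin.suc (Fin.suc j)) (Fin.suc Fin.zero)    e =
        ⊥-elim (pendant-colour≢clique-colour j l e)
      witness-colours-injective (Fin.suc (Fin.suc j)) (Fin.suc (Fin.suc j')) e with j ≟ᶠ j'
      ... | yes refl = refl
      ... | no j≢j'  = ⊥-elim (pendant-colours-distinct j j' j≢j' e)

mainTheorem12 : ∀ (p : ℕ) → 2 ≤ p → ∀ (w : ℕ) → IsCliqueNumber (Q2 p) w → IsChiRlid (Q2 p) (w + 1)
mainTheorem12 (suc (suc q)) (s≤s (s≤s z≤n)) w ω rewrite Q₂.cliqueNumber≡ q ω | +-comm q 1 =
  (colouring , colouring-rlid , colouring<) , λ m c rlid c<m → ≤⇒≯ (rlid-colours≥ c rlid c<m)
  where open Q₂ q
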